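{- Let $p\geq 2$ and let $G$ be a connected $K_{1,p+1}$-free $2p$-regular graph. If $G$ is $(p+2)$-star colourable, then $G$ is a locally linear graph and a clique graph, and $K(K(G))\cong G$.
   Context: Graphs are finite and simple. $K_{1,p+1}$-free means no induced subgraph isomorphic to $K_{1,p+1}$. A $k$-star colouring is a proper colouring with $k$ colours such that the subgraph induced by any two colour classes has every component a star. A graph is locally linear if every edge lies in exactly one triangle. The clique graph $K(G)$ is the intersection graph of the maximal cliques of $G$; a graph is a clique graph if it is isomorphic to $K(H)$ for some graph $H$. -}

module Defs where

open import Data.Nat using (ℕ; zero; suc)
open import Data.Bool using (Bool; true; false; _∧_; _∨_; not; T)
open import Data.Bool.Properties using (∧-comm)
open import Data.Fin using (Fin; _≟_)
open import Data.Vec using (Vec; []; _∷_; lookup; _[_]≔_)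
open import Data.List using (List; []; _∷_; _++_; map; length; filterᵇ; allFin)
open import Data.Bool.ListAction using (all)
import Data.List as L
open import Data.Product using (Σ; ∃; _×_; _,_)
open import Data.Sum using (_⊎_)
open import Data.Empty using (⊥-elim)
open import Relation.Nullary using (¬_; yes; no)
open import Relation.Nullary.Decidable using (⌊_⌋)
open import Relation.Binary.PropositionalEquality using (_≡_; _≢_; refl; sym; cong₂)
open import Function.Bundles using (_↔_; Inverse)

record Graph : Set where
  field
    size   : ℕ
    adj    : Fin size → Fin size → Bool
    adjSym : ∀ i j → adj i j ≡ adj j i
    adjIrr : ∀ i → adj i i ≡ false

open Graph public

V : Graph → Set
V G = Fin (size G)

E : (G : Graph) → V G → V G → Set
E G u v = T (adj G u v)

degree : (G : Graph) → V G → ℕ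
degree G v = length (filterᵇ (adj G v) (allFin (size G)))

Regular : ℕ → Graph → Set
Regular d G = ∀ v → degree G v ≡ d

data Reach (G : Graph) : V G → V G → Set where
  here : ∀ {u} → Reach G u u
  step : ∀ {u v w} → E G u v → Reach G v w → Reach G u w

Connected : Graph → Set
Connected G = ∀ u v → Reach G u v

-- G contains no induced K_{1,q}: there is no centre c together with q
-- distinct neighbours of c that are pairwise non-adjacent.
K1-Free : ℕ → Graph → Set
K1-Free q G =
  ¬ (Σ (V G) λ c → Σ (Fin q → V G) λ f →
       (∀ i → E G c (f i)) ×
       (∀ i j → f i ≡ f j → i ≡ j) ×
       (∀ i j → i ≢ j → ¬ E G (f i) (f j)))

data ReachIn (G : Graph) (W : V G → Set) : V G → V G → Set where
  here : ∀ {u} → W u → ReachIn G W u u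
  step : ∀ {u v w} → W u → E G u v → ReachIn G W v w → ReachIn G W u w

-- every connected component of the induced subgraph G[W] is a star:
-- the component of x contains a vertex z incident with every edge of
-- the component (a connected graph with such a vertex is a star K_{1,m}).
ComponentsAreStars : (G : Graph) → (V G → Set) → Set
ComponentsAreStars G W =
  ∀ x → W x → Σ (V G) λ z → ReachIn G W x z ×
    (∀ u v → ReachIn G W x u → ReachIn G W x v → E G u v → u ≡ z ⊎ v ≡ z)

ProperColouring : (G : Graph) (k : ℕ) → (V G → Fin k) → Set
ProperColouring G k c = ∀ u v → E G u v → c u ≢ c v

IsStarColouring : (G : Graph) (k : ℕ) → (V G → Fin k) → Set
IsStarColouring G k c =
  ProperColouring G k c ×
  (∀ a b → a ≢ b → ComponentsAreStars G (λ v → c v ≡ a ⊎ c v ≡ b))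

StarColourable : ℕ → Graph → Set
StarColourable k G = Σ (V G → Fin k) (IsStarColouring G k)

LocallyLinear : Graph → Set
LocallyLinear G =
  ∀ u v → E G u v → Σ (V G) λ w → (E G u w × E G v w) ×
    (∀ w' → E G u w' → E G v w' → w' ≡ w)

record _≅_ (G H : Graph) : Set where
  field
    bij      : V G ↔ V H
    preserve : ∀ u v → adj H (Inverse.to bij u) (Inverse.to bij v) ≡ adj G u v

-- Clique graph K(G): vertices are the maximal cliques of G (as subsets
-- Vec Bool (size G), listed without repetition), two distinct maximal
-- cliques being adjacent iff they intersect.

Subset : ℕ → Set
Subset n = Vec Bool n

allSubsets : (n : ℕ) → List (Subset n)
allSubsets zero = [] ∷ []
allSubsets (suc n) = map (true ∷_) (allSubsets n) ++ map (false ∷_) (allSubsets n)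

eqᵇ : ∀ {n} → Fin n → Fin n → Bool
eqᵇ i j = ⌊ i ≟ j ⌋

nonemptyᵇ : ∀ {n} → Subset n → Bool
nonemptyᵇ [] = false
nonemptyᵇ (x ∷ xs) = x ∨ nonemptyᵇ xs

meetsᵇ : ∀ {n} → Subset n → Subset n → Bool
meetsᵇ [] [] = false
meetsᵇ (x ∷ xs) (y ∷ ys) = (x ∧ y) ∨ meetsᵇ xs ys

isCliqueᵇ : (G : Graph) → Subset (size G) → Bool
isCliqueᵇ G S =
  all (λ i → all (λ j → not (lookup S i ∧ lookup S j) ∨ eqᵇ i j ∨ adj G i j)
                 (allFin (size G)))
      (allFin (size G))

isMaxCliqueᵇ : (G : Graph) → Subset (size G) → Bool
isMaxCliqueᵇ G S =
  nonemptyᵇ S ∧ isCliqueᵇ G S ∧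
  all (λ v → lookup S v ∨ not (isCliqueᵇ G (S [ v ]≔ true))) (allFin (size G))

maxCliques : (G : Graph) → List (Subset (size G))
maxCliques G = filterᵇ (isMaxCliqueᵇ G) (allSubsets (size G))

private
  eqᵇ-sym : ∀ {n} (i j : Fin n) → eqᵇ i j ≡ eqᵇ j i
  eqᵇ-sym i j with i ≟ j | j ≟ i
  ... | yes _ | yes _ = refl
  ... | no _  | no _  = refl
  ... | yes p | no q  = ⊥-elim (q (sym p))
  ... | no p  | yes q = ⊥-elim (p (sym q))

  eqᵇ-refl : ∀ {n} (i : Fin n) → eqᵇ i i ≡ true
  eqᵇ-refl i with i ≟ i
  ... | yes _ = refl
  ... | no p  = ⊥-elim (p refl)

  meetsᵇ-sym : ∀ {n} (S T : Subset n) → meetsᵇ S T ≡ meetsᵇ T S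
  meetsᵇ-sym [] [] = refl
  meetsᵇ-sym (x ∷ xs) (y ∷ ys) = cong₂ _∨_ (∧-comm x y) (meetsᵇ-sym xs ys)

K : Graph → Graph
K G = record
  { size   = length (maxCliques G)
  ; adj    = kadj
  ; adjSym = λ i j → cong₂ (λ a b → not a ∧ b) (eqᵇ-sym i j)
                       (meetsᵇ-sym (L.lookup (maxCliques G) i) (L.lookup (maxCliques G) j))
  ; adjIrr = λ i → irr i
  }
  where
  kadj : Fin (length (maxCliques G)) → Fin (length (maxCliques G)) → Bool
  kadj i j = not (eqᵇ i j) ∧ meetsᵇ (L.lookup (maxCliques G) i) (L.lookup (maxCliques G) j)
  irr : ∀ i → kadj i i ≡ false
  irr i rewrite eqᵇ-refl i = refl

IsCliqueGraph : Graph → Set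
IsCliqueGraph G = Σ Graph λ H → K H ≅ G

{-# OPTIONS --safe #-}
module Submission where

-- Call a neighbour u of v lone (at v) if no other neighbour of v has the colour of u.  In a
-- star colouring every edge is lone at one of its ends, since otherwise it extends to a
-- bicoloured P₄.  With p + 2 colours a vertex has at most p lone neighbours, so counting the
-- edges of the 2p-regular graph twice shows that every vertex has exactly p lone neighbours and
-- every edge is lone at exactly one end; the other p neighbours of v then share one colour β v.
-- For an edge vu with u lone at v, claw-freeness makes u adjacent to one of the p pairwise
-- non-adjacent neighbours of v of colour β v, and comparing colours with β shows that this
-- common neighbour is unique, so G is locally linear.  In a locally linear graph in which every
-- vertex has two non-adjacent neighbours the maximal cliques are the triangles, the triangles
-- through a vertex form a maximal clique of K G, and by a Helly-type argument every maximal
-- clique of K G arises in this way; this identifies K (K G) with G.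

open import Defs
open import Data.Bool using (Bool; true; false; _∧_; _∨_; not; T; T?; if_then_else_)
open import Data.Bool.ListAction using (all)
open import Data.Bool.Properties using (T-∧; T-∨)
open import Data.Empty using (⊥; ⊥-elim)
open import Data.Fin using (Fin; zero; suc; inject≤)
open import Data.Fin.Patterns using (0F; 1F; 2F)
open import Data.Fin.Properties using (inject≤-injective; injective⇒≤; ¬∀⟶∃¬; all?; any?)
  renaming (_≟_ to _≟ᶠ_)
open import Data.List using (List; _∷_; map; length; filterᵇ; tabulate; allFin)
import Data.List as List
open import Data.List.Membership.Propositional using (_∈_)
open import Data.List.Membership.Propositional.Properties
  using (∈-lookup; ∈-filter⁺; ∈-filter⁻; ∈-map⁺; ∈-map⁻; ∈-++⁺ˡ; ∈-++⁺ʳ)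
open import Data.List.Relation.Unary.All as All using ()
open import Data.List.Relation.Unary.All.Properties using (all⁺; all⁻; tabulate⁺; tabulate⁻)
open import Data.List.Relation.Unary.AllPairs using ([]; _∷_)
open import Data.List.Relation.Unary.Any using (here; index)
open import Data.List.Relation.Unary.Any.Properties using (lookup-index)
open import Data.List.Relation.Unary.Unique.Propositional using (Unique)
open import Data.List.Relation.Unary.Unique.Propositional.Properties using (filter⁺; allFin⁺; map⁺; ++⁺)
open import Data.Nat using (ℕ; zero; suc; _≤_; _+_; _*_; z≤n; s≤s; _≤?_)
open import Data.Nat.Properties
  using ( +-0-commutativeMonoid; +-comm; +-identityʳ; +-cancelʳ-≡; +-mono-≤; +-monoˡ-≤; +-monoʳ-≤
        ; +-mono-<; +-cancelˡ-≤; +-cancelʳ-≤; ≤-antisym; ≤-trans; ≤-reflexive; ≤-pred; <⇒≱; ≮⇒≥; ≰⇒>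
        ; 1+n≰n; n≤0⇒n≡0; module ≤-Reasoning )
open import Data.Product using (Σ; ∃; _×_; _,_; proj₁; proj₂)
open import Data.Sum using (_⊎_; inj₁; inj₂)
open import Data.Vec using ([]; _∷_; lookup; _[_]≔_)
import Data.Vec as Vec
open import Data.Vec.Properties
  using (lookup∘update; lookup∘update′; ∷-injectiveʳ; lookup∘tabulate; tabulate∘lookup; tabulate-cong)
import Data.Vec.Functional as Vector
open import Function using (_∘_; id; case_of_; Injective)
open import Function.Bundles using (Equivalence; mk↔ₛ′)
open import Relation.Binary.PropositionalEquality
open import Relation.Nullary using (¬_; Dec; yes; no)
open import Relation.Nullary.Decidable
  using (⌊_⌋; toWitness; fromWitness; map′; decidable-stable; ¬?; _×-dec_; _⊎-dec_; _→-dec_)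
open import Relation.Unary using (Decidable)

open import Algebra.Properties.CommutativeMonoid.Sum +-0-commutativeMonoid
  using (sum-syntax; ∑-distrib-+; ∑-comm; sum-cong-≗)

T-not⇒¬T : ∀ {b} → T (not b) → ¬ T b
T-not⇒¬T {true} ()

¬T⇒T-not : ∀ {b} → ¬ T b → T (not b)
¬T⇒T-not {true}  ¬b = ¬b _
¬T⇒T-not {false} _  = _

T-injective : ∀ {a b} → (T a → T b) → (T b → T a) → a ≡ b
T-injective {true}  {true}  _ _ = refl
T-injective {true}  {false} f _ = ⊥-elim (f _)
T-injective {false} {true}  _ g = ⊥-elim (g _)
T-injective {false} {false} _ _ = refl

all-allFin⁻ : ∀ {n} (p : Fin n → Bool) → T (all p (allFin n)) → ∀ i → T (p i)
all-allFin⁻ p h = tabulate⁻ (all⁺ p _ h)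

all-allFin⁺ : ∀ {n} (p : Fin n → Bool) → (∀ i → T (p i)) → T (all p (allFin n))
all-allFin⁺ p h = all⁻ p (tabulate⁺ h)

counterexample : ∀ {n} {P Q : Fin n → Set} → Decidable P → Decidable Q →
  ¬ (∀ i → P i → Q i) → ∃ λ i → P i × ¬ Q i
counterexample P? Q? ¬∀ =
  i , decidable-stable (P? i) (λ ¬Pi → ¬[Pi→Qi] (⊥-elim ∘ ¬Pi)) , λ Qi → ¬[Pi→Qi] (λ _ → Qi)
  where
  witness = ¬∀⟶∃¬ _ _ (λ i → P? i →-dec Q? i) ¬∀
  i = proj₁ witness
  ¬[Pi→Qi] = proj₂ witness

-- Finite sums and counting

ind : Bool → ℕ
ind b = if b then 1 else 0

T⇒ind≡1 : ∀ {b} → T b → ind b ≡ 1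
T⇒ind≡1 {true} _ = refl

ind-≤-+ : ∀ {a b c} → (T a → T b ⊎ T c) → ind a ≤ ind b + ind c
ind-≤-+ {false}                _ = z≤n
ind-≤-+ {true} {true}          _ = s≤s z≤n
ind-≤-+ {true} {false} {true}  _ = s≤s z≤n
ind-≤-+ {true} {false} {false} h with h _
... | inj₁ ()
... | inj₂ ()

count : ∀ {n} → (Fin n → Bool) → ℕ
count {n} P = ∑[ i < n ] ind (P i)

count-split : ∀ {n} (P Q : Fin n → Bool) →
  count P ≡ count (λ i → P i ∧ Q i) + count (λ i → P i ∧ not (Q i))
count-split P Q = trans (sum-cong-≗ λ i → split (P i) (Q i)) (∑-distrib-+ (λ i → ind (P i ∧ Q i)) _)
  where
  split : ∀ a b → ind a ≡ ind (a ∧ b) + ind (a ∧ not b)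
  split true  true  = refl
  split true  false = refl
  split false _     = refl

∑-mono-≤ : ∀ {n} {f g : Fin n → ℕ} → (∀ i → f i ≤ g i) → ∑[ i < n ] f i ≤ ∑[ i < n ] g i
∑-mono-≤ {zero}  f≤g = z≤n
∑-mono-≤ {suc n} f≤g = +-mono-≤ (f≤g zero) (∑-mono-≤ (f≤g ∘ suc))

∑-mono-≤-tight : ∀ {n} {f g : Fin n → ℕ} → (∀ i → f i ≤ g i) →
  ∑[ i < n ] g i ≤ ∑[ i < n ] f i → ∀ i → f i ≡ g i
∑-mono-≤-tight {suc n} {f} {g} f≤g ∑g≤∑f = pointwise
  where
  ∑f∘suc≤∑g∘suc : ∑[ i < n ] f (suc i) ≤ ∑[ i < n ] g (suc i)
  ∑f∘suc≤∑g∘suc = ∑-mono-≤ (f≤g ∘ suc)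
  g₀≤f₀ : g zero ≤ f zero
  g₀≤f₀ = +-cancelʳ-≤ _ _ _ (≤-trans ∑g≤∑f (+-monoʳ-≤ (f zero) ∑f∘suc≤∑g∘suc))
  ∑g∘suc≤∑f∘suc : ∑[ i < n ] g (suc i) ≤ ∑[ i < n ] f (suc i)
  ∑g∘suc≤∑f∘suc = +-cancelˡ-≤ (g zero) _ _ (≤-trans ∑g≤∑f (+-monoˡ-≤ _ (f≤g zero)))
  pointwise : ∀ i → f i ≡ g i
  pointwise zero    = ≤-antisym (f≤g zero) g₀≤f₀
  pointwise (suc i) = ∑-mono-≤-tight (f≤g ∘ suc) ∑g∘suc≤∑f∘suc i

∑∑-mono-≤-tight : ∀ {n} {f g : Fin n → Fin n → ℕ} → (∀ i j → f i j ≤ g i j) →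
  ∑[ i < n ] ∑[ j < n ] g i j ≤ ∑[ i < n ] ∑[ j < n ] f i j → ∀ i j → f i j ≡ g i j
∑∑-mono-≤-tight f≤g ∑∑g≤∑∑f i =
  ∑-mono-≤-tight (f≤g i) (≤-reflexive (sym (∑-mono-≤-tight (λ i → ∑-mono-≤ (f≤g i)) ∑∑g≤∑∑f i)))

∑∑-symmetrise : ∀ {n} (f : Fin n → Fin n → ℕ) →
  ∑[ i < n ] ∑[ j < n ] (f i j + f j i) ≡ ∑[ i < n ] ∑[ j < n ] f i j + ∑[ i < n ] ∑[ j < n ] f i j
∑∑-symmetrise {n} f = begin
  ∑[ i < n ] ∑[ j < n ] (f i j + f j i)                      ≡⟨ sum-cong-≗ (λ i → ∑-distrib-+ (f i) (λ j → f j i)) ⟩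
  ∑[ i < n ] (∑[ j < n ] f i j + ∑[ j < n ] f j i)           ≡⟨ ∑-distrib-+ (λ i → ∑[ j < n ] f i j) _ ⟩
  ∑[ i < n ] ∑[ j < n ] f i j + ∑[ i < n ] ∑[ j < n ] f j i  ≡⟨ cong (∑[ i < n ] ∑[ j < n ] f i j +_) (∑-comm (λ i j → f j i)) ⟩
  ∑[ i < n ] ∑[ j < n ] f i j + ∑[ i < n ] ∑[ j < n ] f i j  ∎
  where open ≡-Reasoning

m+m≤n+n⇒m≤n : ∀ {m n} → m + m ≤ n + n → m ≤ n
m+m≤n+n⇒m≤n m+m≤n+n = ≮⇒≥ λ n<m → <⇒≱ (+-mono-< n<m n<m) m+m≤n+n

length-filterᵇ-tabulate : ∀ {A : Set} {n} (P : A → Bool) (f : Fin n → A) →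
  length (filterᵇ P (tabulate f)) ≡ count (P ∘ f)
length-filterᵇ-tabulate {n = zero}  P f = refl
length-filterᵇ-tabulate {n = suc n} P f with P (f zero)
... | true  = cong suc (length-filterᵇ-tabulate P (f ∘ suc))
... | false = length-filterᵇ-tabulate P (f ∘ suc)

lookup-injective : ∀ {A : Set} {xs : List A} → Unique xs → Injective _≡_ _≡_ (List.lookup xs)
lookup-injective {xs = x ∷ xs} (x∉xs ∷ u) {zero}  {zero}  eq = refl
lookup-injective {xs = x ∷ xs} (x∉xs ∷ u) {zero}  {suc j} eq = ⊥-elim (All.lookup x∉xs (∈-lookup j) eq)
lookup-injective {xs = x ∷ xs} (x∉xs ∷ u) {suc i} {zero}  eq = ⊥-elim (All.lookup x∉xs (∈-lookup i) (sym eq))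
lookup-injective {xs = x ∷ xs} (x∉xs ∷ u) {suc i} {suc j} eq = cong suc (lookup-injective u eq)

choose : ∀ {n m} (P : Fin n → Bool) → m ≤ count P →
  Σ (Fin m → Fin n) λ g → Injective _≡_ _≡_ g × (∀ i → T (P (g i)))
choose {n} P m≤#P = g , g-injective , g-satisfies
  where
  members : List (Fin n)
  members = filterᵇ P (allFin n)
  m≤length : _ ≤ length members
  m≤length = ≤-trans m≤#P (≤-reflexive (sym (length-filterᵇ-tabulate P id)))
  g : _ → Fin n
  g i = List.lookup members (inject≤ i m≤length)
  g-injective : Injective _≡_ _≡_ g
  g-injective eq = inject≤-injective _ _ _ _ (lookup-injective (filter⁺ (T? ∘ P) (allFin⁺ n)) eq)
  g-satisfies : ∀ i → T (P (g i))
  g-satisfies i = proj₂ (∈-filter⁻ (T? ∘ P) {xs = allFin n} (∈-lookup (inject≤ i m≤length)))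

∷-injective : ∀ {A B : Set} {n} (f : A → B) {x : A} {g : Fin n → A} →
  (∀ i → f (g i) ≢ f x) → Injective _≡_ _≡_ (f ∘ g) → Injective _≡_ _≡_ (f ∘ (x Vector.∷ g))
∷-injective f fg≢fx fg-injective {zero}  {zero}  _  = refl
∷-injective f fg≢fx fg-injective {zero}  {suc j} eq = ⊥-elim (fg≢fx j (sym eq))
∷-injective f fg≢fx fg-injective {suc i} {zero}  eq = ⊥-elim (fg≢fx i eq)
∷-injective f fg≢fx fg-injective {suc i} {suc j} eq = cong suc (fg-injective eq)

-- Maximal cliques and clique graphs

E-sym : ∀ (G : Graph) {u v} → E G u v → E G v u
E-sym G {u} {v} = subst T (adjSym G u v)

E-irrefl : ∀ (G : Graph) {u v} → E G u v → u ≢ v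
E-irrefl G {u} e refl = subst T (adjIrr G u) e

_∈ₛ_ : ∀ {n} → Fin n → Subset n → Set
i ∈ₛ S = T (lookup S i)

∈-update⁻ : ∀ {n} (S : Subset n) {v x b} → x ≢ v → x ∈ₛ (S [ v ]≔ b) → x ∈ₛ S
∈-update⁻ S x≢v = subst T (lookup∘update′ x≢v S _)

∈-update⁺ : ∀ {n} (S : Subset n) {v x b} → x ≢ v → x ∈ₛ S → x ∈ₛ (S [ v ]≔ b)
∈-update⁺ S x≢v = subst T (sym (lookup∘update′ x≢v S _))

⊆-antisym : ∀ {n} {S R : Subset n} → (∀ {x} → x ∈ₛ S → x ∈ₛ R) → (∀ {x} → x ∈ₛ R → x ∈ₛ S) → S ≡ R
⊆-antisym {S = S} {R} S⊆R R⊆S = begin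
  S                        ≡⟨ tabulate∘lookup S ⟨
  Vec.tabulate (lookup S)  ≡⟨ tabulate-cong (λ _ → T-injective S⊆R R⊆S) ⟩
  Vec.tabulate (lookup R)  ≡⟨ tabulate∘lookup R ⟩
  R                        ∎
  where open ≡-Reasoning

Meet : ∀ {n} → Subset n → Subset n → Set
Meet S R = ∃ λ i → i ∈ₛ S × i ∈ₛ R

nonemptyᵇ⁻ : ∀ {n} (S : Subset n) → T (nonemptyᵇ S) → ∃ (_∈ₛ S)
nonemptyᵇ⁻ (true  ∷ S) _ = zero , _
nonemptyᵇ⁻ (false ∷ S) h = let i , i∈S = nonemptyᵇ⁻ S h in suc i , i∈S

nonemptyᵇ⁺ : ∀ {n} (S : Subset n) {i} → i ∈ₛ S → T (nonemptyᵇ S)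
nonemptyᵇ⁺ (true  ∷ S)         _   = _
nonemptyᵇ⁺ (false ∷ S) {suc i} i∈S = nonemptyᵇ⁺ S i∈S

meetsᵇ⁻ : ∀ {n} (S R : Subset n) → T (meetsᵇ S R) → Meet S R
meetsᵇ⁻ []          []          ()
meetsᵇ⁻ (true  ∷ S) (true  ∷ R) _ = zero , _ , _
meetsᵇ⁻ (true  ∷ S) (false ∷ R) h = let i , i∈S , i∈R = meetsᵇ⁻ S R h in suc i , i∈S , i∈R
meetsᵇ⁻ (false ∷ S) (_     ∷ R) h = let i , i∈S , i∈R = meetsᵇ⁻ S R h in suc i , i∈S , i∈R

meetsᵇ⁺ : ∀ {n} (S R : Subset n) → Meet S R → T (meetsᵇ S R)
meetsᵇ⁺ (true ∷ S) (true ∷ R) (zero , _ , _) = _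
meetsᵇ⁺ (x ∷ S) (y ∷ R) (suc i , i∈S , i∈R) =
  Equivalence.from (T-∨ {x ∧ y}) (inj₂ (meetsᵇ⁺ S R (i , i∈S , i∈R)))

meet? : ∀ {n} (S R : Subset n) → Dec (Meet S R)
meet? S R = map′ (meetsᵇ⁻ S R) (meetsᵇ⁺ S R) (T? (meetsᵇ S R))

IsClique : (G : Graph) → Subset (size G) → Set
IsClique G S = ∀ {u v} → u ∈ₛ S → v ∈ₛ S → u ≢ v → E G u v

record IsMaximalClique (G : Graph) (S : Subset (size G)) : Set where
  field
    nonempty : ∃ (_∈ₛ S)
    clique   : IsClique G S
    maximal  : ∀ {v} → ¬ v ∈ₛ S → ∃ λ u → u ∈ₛ S × ¬ E G u v

maximal⊆clique⇒≡ : ∀ (G : Graph) {S R} → IsMaximalClique G S → IsClique G R →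
  (∀ {x} → x ∈ₛ S → x ∈ₛ R) → S ≡ R
maximal⊆clique⇒≡ G {S} {R} S-maximal R-clique S⊆R = ⊆-antisym S⊆R R⊆S
  where
  open IsMaximalClique S-maximal
  R⊆S : ∀ {x} → x ∈ₛ R → x ∈ₛ S
  R⊆S {x} x∈R = decidable-stable (T? _) λ x∉S →
    let u , u∈S , ¬ux = maximal x∉S
    in ¬ux (R-clique (S⊆R u∈S) x∈R λ u≡x → x∉S (subst (_∈ₛ S) u≡x u∈S))

private
  clause⁻ : ∀ {a b c d} → T (not (a ∧ b) ∨ c ∨ d) → T a → T b → ¬ T c → T d
  clause⁻ {true}  {true}  {true}  _ _  _  ¬c = ⊥-elim (¬c _)
  clause⁻ {true}  {true}  {false} d _  _  _  = d
  clause⁻ {true}  {false}         _ _  () _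
  clause⁻ {false}                 _ () _  _

  clause⁺ : ∀ {a b c d} → (T a → T b → ¬ T c → T d) → T (not (a ∧ b) ∨ c ∨ d)
  clause⁺ {true}  {true}  {true}  _ = _
  clause⁺ {true}  {true}  {false} h = h _ _ λ ()
  clause⁺ {true}  {false}         _ = _
  clause⁺ {false}                 _ = _

module _ (G : Graph) where

  private
    cliqueClause : Subset (size G) → V G → V G → Bool
    cliqueClause S i j = not (lookup S i ∧ lookup S j) ∨ eqᵇ i j ∨ adj G i j

  isCliqueᵇ⁻ : ∀ S → T (isCliqueᵇ G S) → IsClique G S
  isCliqueᵇ⁻ S h {u} {v} u∈S v∈S u≢v =
    clause⁻ (all-allFin⁻ (cliqueClause S u) (all-allFin⁻ _ h u) v) u∈S v∈S (u≢v ∘ toWitness)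

  isCliqueᵇ⁺ : ∀ S → IsClique G S → T (isCliqueᵇ G S)
  isCliqueᵇ⁺ S clique = all-allFin⁺ _ λ u → all-allFin⁺ (cliqueClause S u) λ v →
    clause⁺ λ u∈S v∈S ¬u≡v → clique u∈S v∈S (¬u≡v ∘ fromWitness)

  insert-clique : ∀ {S v} → IsClique G S → (∀ {u} → u ∈ₛ S → E G u v) → IsClique G (S [ v ]≔ true)
  insert-clique {S} {v} clique adjacent {x} {y} x∈ y∈ x≢y with x ≟ᶠ v | y ≟ᶠ v
  ... | yes refl | yes refl = ⊥-elim (x≢y refl)
  ... | yes refl | no y≢v   = E-sym G (adjacent (∈-update⁻ S y≢v y∈))
  ... | no x≢v   | yes refl = adjacent (∈-update⁻ S x≢v x∈)
  ... | no x≢v   | no y≢v   = clique (∈-update⁻ S x≢v x∈) (∈-update⁻ S y≢v y∈) x≢y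

  isMaxCliqueᵇ⁻ : ∀ S → T (isMaxCliqueᵇ G S) → IsMaximalClique G S
  isMaxCliqueᵇ⁻ S h = record
    { nonempty = nonemptyᵇ⁻ S (proj₁ nonempty×rest)
    ; clique   = clique
    ; maximal  = λ {v} v∉S → counterexample (λ _ → T? _) (λ _ → T? _) λ adjacent →
        not-extendable v∉S (isCliqueᵇ⁺ (S [ v ]≔ true) (insert-clique {S} clique λ {u} → adjacent u))
    }
    where
    nonempty×rest = Equivalence.to (T-∧ {nonemptyᵇ S}) h
    clique×maximal = Equivalence.to (T-∧ {isCliqueᵇ G S}) (proj₂ nonempty×rest)
    clique : IsClique G S
    clique = isCliqueᵇ⁻ S (proj₁ clique×maximal)
    not-extendable : ∀ {v} → ¬ v ∈ₛ S → ¬ T (isCliqueᵇ G (S [ v ]≔ true))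
    not-extendable {v} v∉S with Equivalence.to (T-∨ {lookup S v}) (all-allFin⁻ _ (proj₂ clique×maximal) v)
    ... | inj₁ v∈S         = ⊥-elim (v∉S v∈S)
    ... | inj₂ ¬extendable = T-not⇒¬T ¬extendable

  isMaxCliqueᵇ⁺ : ∀ S → IsMaximalClique G S → T (isMaxCliqueᵇ G S)
  isMaxCliqueᵇ⁺ S S-maximal = Equivalence.from T-∧
    ( nonemptyᵇ⁺ S (proj₂ nonempty)
    , Equivalence.from T-∧ (isCliqueᵇ⁺ S clique , all-allFin⁺ _ λ v → Equivalence.from T-∨ (∈-or-not-extendable v)) )
    where
    open IsMaximalClique S-maximal
    ∈-or-not-extendable : ∀ v → v ∈ₛ S ⊎ T (not (isCliqueᵇ G (S [ v ]≔ true)))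
    ∈-or-not-extendable v with T? (lookup S v)
    ... | yes v∈S = inj₁ v∈S
    ... | no  v∉S = inj₂ (¬T⇒T-not λ extendable →
      let u , u∈S , ¬uv = maximal v∉S
          u≢v : u ≢ v
          u≢v u≡v = v∉S (subst (_∈ₛ S) u≡v u∈S)
      in ¬uv (isCliqueᵇ⁻ (S [ v ]≔ true) extendable (∈-update⁺ S u≢v u∈S)
                                                     (subst T (sym (lookup∘update v S true)) _) u≢v))

allSubsets-unique : ∀ n → Unique (allSubsets n)
allSubsets-unique zero    = All.[] ∷ []
allSubsets-unique (suc n) =
  ++⁺ (map⁺ ∷-injectiveʳ (allSubsets-unique n)) (map⁺ ∷-injectiveʳ (allSubsets-unique n)) disjoint
  where
  disjoint : ∀ {S} → ¬ (S ∈ map (true ∷_) (allSubsets n) × S ∈ map (false ∷_) (allSubsets n))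
  disjoint (∈true , ∈false) with ∈-map⁻ (true ∷_) ∈true | ∈-map⁻ (false ∷_) ∈false
  ... | _ , _ , refl | _ , _ , ()

∈-allSubsets : ∀ {n} (S : Subset n) → S ∈ allSubsets n
∈-allSubsets []          = here refl
∈-allSubsets (true  ∷ S) = ∈-++⁺ˡ (∈-map⁺ (true ∷_) (∈-allSubsets S))
∈-allSubsets (false ∷ S) = ∈-++⁺ʳ _ (∈-map⁺ (false ∷_) (∈-allSubsets S))

module _ (G : Graph) where

  maxClique : V (K G) → Subset (size G)
  maxClique = List.lookup (maxCliques G)

  maxClique-maximal : ∀ i → IsMaximalClique G (maxClique i)
  maxClique-maximal i =
    isMaxCliqueᵇ⁻ G _ (proj₂ (∈-filter⁻ (T? ∘ isMaxCliqueᵇ G) {xs = allSubsets (size G)} (∈-lookup i)))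

  maxClique-injective : Injective _≡_ _≡_ maxClique
  maxClique-injective = lookup-injective (filter⁺ (T? ∘ isMaxCliqueᵇ G) (allSubsets-unique (size G)))

  maxClique-surjective : ∀ {S} → IsMaximalClique G S → ∃ λ i → maxClique i ≡ S
  maxClique-surjective {S} S-maximal = index S∈ , sym (lookup-index S∈)
    where
    S∈ : S ∈ maxCliques G
    S∈ = ∈-filter⁺ (T? ∘ isMaxCliqueᵇ G) (∈-allSubsets S) (isMaxCliqueᵇ⁺ G S S-maximal)

  E-K⁻ : ∀ {i j} → E (K G) i j → Meet (maxClique i) (maxClique j)
  E-K⁻ {i} {j} e = meetsᵇ⁻ (maxClique i) (maxClique j) (proj₂ (Equivalence.to (T-∧ {not (eqᵇ i j)}) e))

  E-K⁺ : ∀ {i j} → i ≢ j → Meet (maxClique i) (maxClique j) → E (K G) i j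
  E-K⁺ {i} {j} i≢j meet =
    Equivalence.from T-∧ (¬T⇒T-not (i≢j ∘ toWitness) , meetsᵇ⁺ (maxClique i) (maxClique j) meet)

module _ (H G : Graph) (star : V G → Subset (size H))
  (star-maximal    : ∀ v → IsMaximalClique H (star v))
  (star-surjective : ∀ {S} → IsMaximalClique H S → ∃ λ v → star v ≡ S)
  (star-injective  : Injective _≡_ _≡_ star)
  (meet⇒E          : ∀ {u v} → u ≢ v → Meet (star u) (star v) → E G u v)
  (E⇒meet          : ∀ {u v} → E G u v → Meet (star u) (star v))
  where

  private
    to : V (K H) → V G
    to k = proj₁ (star-surjective (maxClique-maximal H k))

    star∘to : ∀ k → star (to k) ≡ maxClique H k
    star∘to k = proj₂ (star-surjective (maxClique-maximal H k))

    from : V G → V (K H)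
    from v = proj₁ (maxClique-surjective H (star-maximal v))

    maxClique∘from : ∀ v → maxClique H (from v) ≡ star v
    maxClique∘from v = proj₂ (maxClique-surjective H (star-maximal v))

    to∘from : ∀ v → to (from v) ≡ v
    to∘from v = star-injective (trans (star∘to (from v)) (maxClique∘from v))

    from∘to : ∀ k → from (to k) ≡ k
    from∘to k = maxClique-injective H (trans (maxClique∘from (to k)) (star∘to k))

    meet-to : ∀ {k l} → Meet (star (to k)) (star (to l)) ≡ Meet (maxClique H k) (maxClique H l)
    meet-to {k} {l} = cong₂ Meet (star∘to k) (star∘to l)

    E-to⁺ : ∀ {k l} → E (K H) k l → E G (to k) (to l)
    E-to⁺ {k} {l} e = meet⇒E to-distinct (subst id (sym meet-to) (E-K⁻ H e))
      where
      to-distinct : to k ≢ to l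
      to-distinct eq = E-irrefl (K H) e (trans (sym (from∘to k)) (trans (cong from eq) (from∘to l)))

    E-to⁻ : ∀ {k l} → E G (to k) (to l) → E (K H) k l
    E-to⁻ e = E-K⁺ H (λ { refl → E-irrefl G e refl }) (subst id meet-to (E⇒meet e))

  K≅ : K H ≅ G
  K≅ = record
    { bij      = mk↔ₛ′ to from to∘from from∘to
    ; preserve = λ _ _ → T-injective E-to⁻ E-to⁺
    }

-- Locally linear graphs

record NonadjacentNeighbours (G : Graph) (v : V G) : Set where
  field
    u₁ u₂       : V G
    adjacent₁   : E G v u₁
    adjacent₂   : E G v u₂
    distinct    : u₁ ≢ u₂
    nonadjacent : ¬ E G u₁ u₂

module LocallyLinearGraph (G : Graph) (locallyLinear : LocallyLinear G) where

  apex : ∀ {u v} → E G u v → V G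
  apex {u} {v} e = proj₁ (locallyLinear u v e)

  apex-adjacent : ∀ {u v} (e : E G u v) → E G u (apex e) × E G v (apex e)
  apex-adjacent {u} {v} e = proj₁ (proj₂ (locallyLinear u v e))

  apex-unique : ∀ {u v w} (e : E G u v) → E G u w → E G v w → w ≡ apex e
  apex-unique {u} {v} e = proj₂ (proj₂ (locallyLinear u v e)) _

  nonadjacent-among-three : ∀ {v a b c} → E G v a → E G v b → E G v c → a ≢ b → a ≢ c → b ≢ c →
    NonadjacentNeighbours G v
  nonadjacent-among-three {v} {a} {b} {c} va vb vc a≢b a≢c b≢c with T? (adj G a b) | T? (adj G a c)
  ... | no ¬ab | _      = record { adjacent₁ = va ; adjacent₂ = vb ; distinct = a≢b ; nonadjacent = ¬ab }
  ... | yes _  | no ¬ac = record { adjacent₁ = va ; adjacent₂ = vc ; distinct = a≢c ; nonadjacent = ¬ac }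
  ... | yes ab | yes ac = ⊥-elim (b≢c (trans (apex-unique va vb ab) (sym (apex-unique va vc ac))))

  nonadjacent-neighbours : ∀ {v} → 3 ≤ degree G v → NonadjacentNeighbours G v
  nonadjacent-neighbours {v} 3≤deg =
    nonadjacent-among-three (adjacent 0F) (adjacent 1F) (adjacent 2F)
      (λ eq → case injective eq of λ ()) (λ eq → case injective eq of λ ()) (λ eq → case injective eq of λ ())
    where
    neighbours = choose (adj G v) (≤-trans 3≤deg (≤-reflexive (length-filterᵇ-tabulate (adj G v) id)))
    injective = proj₁ (proj₂ neighbours)
    adjacent  = proj₂ (proj₂ neighbours)

  triangle : ∀ {u v} → E G u v → Subset (size G)
  triangle {u} {v} e = Vec.tabulate λ x → ⌊ x ≟ᶠ u ⊎-dec x ≟ᶠ v ⊎-dec x ≟ᶠ apex e ⌋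

  ∈-triangle⁻ : ∀ {u v x} (e : E G u v) → x ∈ₛ triangle e → x ≡ u ⊎ x ≡ v ⊎ x ≡ apex e
  ∈-triangle⁻ {x = x} e = toWitness ∘ subst T (lookup∘tabulate _ x)

  ∈-triangle⁺ : ∀ {u v x} (e : E G u v) → x ≡ u ⊎ x ≡ v ⊎ x ≡ apex e → x ∈ₛ triangle e
  ∈-triangle⁺ {x = x} e = subst T (sym (lookup∘tabulate _ x)) ∘ fromWitness

  triangle-clique : ∀ {u v} (e : E G u v) → IsClique G (triangle e)
  triangle-clique e x∈ y∈ x≢y with ∈-triangle⁻ e x∈ | ∈-triangle⁻ e y∈
  ... | inj₁ refl        | inj₁ refl        = ⊥-elim (x≢y refl)
  ... | inj₁ refl        | inj₂ (inj₁ refl) = e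
  ... | inj₁ refl        | inj₂ (inj₂ refl) = proj₁ (apex-adjacent e)
  ... | inj₂ (inj₁ refl) | inj₁ refl        = E-sym G e
  ... | inj₂ (inj₁ refl) | inj₂ (inj₁ refl) = ⊥-elim (x≢y refl)
  ... | inj₂ (inj₁ refl) | inj₂ (inj₂ refl) = proj₂ (apex-adjacent e)
  ... | inj₂ (inj₂ refl) | inj₁ refl        = E-sym G (proj₁ (apex-adjacent e))
  ... | inj₂ (inj₂ refl) | inj₂ (inj₁ refl) = E-sym G (proj₂ (apex-adjacent e))
  ... | inj₂ (inj₂ refl) | inj₂ (inj₂ refl) = ⊥-elim (x≢y refl)

  triangle-maximal : ∀ {u v} (e : E G u v) → IsMaximalClique G (triangle e)
  triangle-maximal {u} {v} e = record
    { nonempty = u , ∈-triangle⁺ e (inj₁ refl)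
    ; clique   = triangle-clique e
    ; maximal  = non-neighbour
    }
    where
    non-neighbour : ∀ {x} → ¬ x ∈ₛ triangle e → ∃ λ y → y ∈ₛ triangle e × ¬ E G y x
    non-neighbour {x} x∉ with T? (adj G u x) | T? (adj G v x)
    ... | no ¬ux | _      = u , ∈-triangle⁺ e (inj₁ refl) , ¬ux
    ... | yes _  | no ¬vx = v , ∈-triangle⁺ e (inj₂ (inj₁ refl)) , ¬vx
    ... | yes ux | yes vx = ⊥-elim (x∉ (∈-triangle⁺ e (inj₂ (inj₂ (apex-unique e ux vx)))))

  apex-∈ : ∀ {C u v} → IsMaximalClique G C → u ∈ₛ C → v ∈ₛ C → (e : E G u v) → apex e ∈ₛ C
  apex-∈ {C} C-maximal u∈C v∈C e = decidable-stable (T? _) λ apex∉C →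
    let y , y∈C , ¬y-apex = maximal apex∉C
        ≢y : ∀ {x} → E G x (apex e) → x ≢ y
        ≢y x-apex x≡y = ¬y-apex (subst (λ z → E G z (apex e)) x≡y x-apex)
        uy = clique u∈C y∈C (≢y (proj₁ (apex-adjacent e)))
        vy = clique v∈C y∈C (≢y (proj₂ (apex-adjacent e)))
    in apex∉C (subst (_∈ₛ C) (apex-unique e uy vy) y∈C)
    where open IsMaximalClique C-maximal

  shared-edge⇒⊆ : ∀ {C D u v} → IsMaximalClique G C → IsMaximalClique G D →
    u ∈ₛ C → v ∈ₛ C → u ∈ₛ D → v ∈ₛ D → u ≢ v → ∀ {x} → x ∈ₛ C → x ∈ₛ D
  shared-edge⇒⊆ {C} {D} {u} {v} C-maximal D-maximal u∈C v∈C u∈D v∈D u≢v {x} x∈C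
    with x ≟ᶠ u | x ≟ᶠ v
  ... | yes refl | _        = u∈D
  ... | no _     | yes refl = v∈D
  ... | no x≢u   | no x≢v   =
    subst (_∈ₛ D) (sym (apex-unique uv (clique u∈C x∈C (x≢u ∘ sym)) (clique v∈C x∈C (x≢v ∘ sym))))
          (apex-∈ D-maximal u∈D v∈D uv)
    where
    open IsMaximalClique C-maximal
    uv = clique u∈C v∈C u≢v

  shared-vertex-unique : ∀ {C D v} → IsMaximalClique G C → IsMaximalClique G D → v ∈ₛ C → v ∈ₛ D →
    (∃ λ x → x ∈ₛ C × ¬ x ∈ₛ D) → ∀ {y} → y ∈ₛ C → y ∈ₛ D → y ≡ v
  shared-vertex-unique C-maximal D-maximal v∈C v∈D (x , x∈C , x∉D) {y} y∈C y∈D =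
    decidable-stable (y ≟ᶠ _) λ y≢v → x∉D (shared-edge⇒⊆ C-maximal D-maximal y∈C v∈C y∈D v∈D y≢v x∈C)

  -- If X met C in a and D in b, then b would be the apex of the edge va and so lie in C.
  ¬meets-both : ∀ {C D X v} → IsMaximalClique G C → IsClique G D → v ∈ₛ C → v ∈ₛ D →
    (∀ {y} → y ∈ₛ C → y ∈ₛ D → y ≡ v) → IsClique G X → ¬ v ∈ₛ X → Meet X C → Meet X D → ⊥
  ¬meets-both {C} {D} {X} {v} C-maximal D-clique v∈C v∈D C∩D⊆v X-clique v∉X
              (a , a∈X , a∈C) (b , b∈X , b∈D) = v∉X (subst (_∈ₛ X) (C∩D⊆v b∈C b∈D) b∈X)
    where
    open IsMaximalClique C-maximal
    ∈X⇒≢v : ∀ {y} → y ∈ₛ X → v ≢ y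
    ∈X⇒≢v y∈X refl = v∉X y∈X
    b∈C : b ∈ₛ C
    b∈C with a ≟ᶠ b
    ... | yes refl = a∈C
    ... | no  a≢b  = subst (_∈ₛ C) (sym (apex-unique va vb (X-clique a∈X b∈X a≢b))) (apex-∈ C-maximal v∈C a∈C va)
      where
      va = clique v∈C a∈C (∈X⇒≢v a∈X)
      vb = D-clique v∈D b∈D (∈X⇒≢v b∈X)

module CliqueGraphOfLocallyLinear (G : Graph) (locallyLinear : LocallyLinear G)
  (wedge : ∀ v → NonadjacentNeighbours G v) where

  open LocallyLinearGraph G locallyLinear

  private
    C : V (K G) → Subset (size G)
    C = maxClique G

    C-maximal : ∀ i → IsMaximalClique G (C i)
    C-maximal = maxClique-maximal G

    C-clique : ∀ i → IsClique G (C i)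
    C-clique i = IsMaximalClique.clique (C-maximal i)

  cliquesAt : V G → Subset (size (K G))
  cliquesAt v = Vec.tabulate λ i → lookup (C i) v

  ∈-cliquesAt⁻ : ∀ {v i} → i ∈ₛ cliquesAt v → v ∈ₛ C i
  ∈-cliquesAt⁻ {v} {i} = subst T (lookup∘tabulate (λ i → lookup (C i) v) i)

  ∈-cliquesAt⁺ : ∀ {v i} → v ∈ₛ C i → i ∈ₛ cliquesAt v
  ∈-cliquesAt⁺ {v} {i} = subst T (sym (lookup∘tabulate (λ i → lookup (C i) v) i))

  cliquesAt-clique : ∀ v → IsClique (K G) (cliquesAt v)
  cliquesAt-clique v i∈ j∈ i≢j = E-K⁺ G i≢j (v , ∈-cliquesAt⁻ i∈ , ∈-cliquesAt⁻ j∈)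

  triangleIndex : ∀ {u v} → E G u v → V (K G)
  triangleIndex e = proj₁ (maxClique-surjective G (triangle-maximal e))

  ∈-triangleIndex : ∀ {u v x} (e : E G u v) → x ≡ u ⊎ x ≡ v ⊎ x ≡ apex e → x ∈ₛ C (triangleIndex e)
  ∈-triangleIndex e = subst (_ ∈ₛ_) (sym (proj₂ (maxClique-surjective G (triangle-maximal e)))) ∘ ∈-triangle⁺ e

  module TrianglesAt (v : V G) where
    open NonadjacentNeighbours (wedge v)

    i₁ i₂ : V (K G)
    i₁ = triangleIndex adjacent₁
    i₂ = triangleIndex adjacent₂

    v∈₁ : v ∈ₛ C i₁
    v∈₁ = ∈-triangleIndex adjacent₁ (inj₁ refl)

    v∈₂ : v ∈ₛ C i₂
    v∈₂ = ∈-triangleIndex adjacent₂ (inj₁ refl)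

    only-v : ∀ {y} → y ∈ₛ C i₁ → y ∈ₛ C i₂ → y ≡ v
    only-v = shared-vertex-unique (C-maximal i₁) (C-maximal i₂) v∈₁ v∈₂ (u₁ , u₁∈₁ , u₁∉₂)
      where
      u₁∈₁ = ∈-triangleIndex adjacent₁ (inj₂ (inj₁ refl))
      u₁∉₂ : ¬ u₁ ∈ₛ C i₂
      u₁∉₂ u₁∈₂ = nonadjacent (C-clique i₂ u₁∈₂ (∈-triangleIndex adjacent₂ (inj₂ (inj₁ refl))) distinct)

  cliquesAt-maximal : ∀ v → IsMaximalClique (K G) (cliquesAt v)
  cliquesAt-maximal v = record
    { nonempty = i₁ , ∈-cliquesAt⁺ v∈₁
    ; clique   = cliquesAt-clique v
    ; maximal  = λ i∉ → disjoint-triangle (i∉ ∘ ∈-cliquesAt⁺)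
    }
    where
    open TrianglesAt v
    disjoint-triangle : ∀ {i} → ¬ v ∈ₛ C i → ∃ λ j → j ∈ₛ cliquesAt v × ¬ E (K G) j i
    disjoint-triangle {i} v∉Ci with meet? (C i) (C i₁) | meet? (C i) (C i₂)
    ... | no ¬m  | _      = i₁ , ∈-cliquesAt⁺ v∈₁ , ¬m ∘ E-K⁻ G ∘ E-sym (K G)
    ... | yes _  | no ¬m  = i₂ , ∈-cliquesAt⁺ v∈₂ , ¬m ∘ E-K⁻ G ∘ E-sym (K G)
    ... | yes m₁ | yes m₂ =
      ⊥-elim (¬meets-both {D = C i₂} {X = C i} (C-maximal i₁) (C-clique i₂) v∈₁ v∈₂ only-v (C-clique i) v∉Ci m₁ m₂)

  cliquesAt-injective : Injective _≡_ _≡_ cliquesAt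
  cliquesAt-injective {u} {v} eq = only-v (u∈ v∈₁) (u∈ v∈₂)
    where
    open TrianglesAt v
    u∈ : ∀ {i} → v ∈ₛ C i → u ∈ₛ C i
    u∈ {i} v∈Ci = ∈-cliquesAt⁻ (subst (i ∈ₛ_) (sym eq) (∈-cliquesAt⁺ v∈Ci))

  meet⇒E : ∀ {u v} → u ≢ v → Meet (cliquesAt u) (cliquesAt v) → E G u v
  meet⇒E u≢v (i , i∈u , i∈v) = C-clique i (∈-cliquesAt⁻ i∈u) (∈-cliquesAt⁻ i∈v) u≢v

  E⇒meet : ∀ {u v} → E G u v → Meet (cliquesAt u) (cliquesAt v)
  E⇒meet e = triangleIndex e
           , ∈-cliquesAt⁺ (∈-triangleIndex e (inj₁ refl))
           , ∈-cliquesAt⁺ (∈-triangleIndex e (inj₂ (inj₁ refl)))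

  -- C i₀ and C j₁ share only v, so a member of M whose clique avoided v would meet both.
  common-vertex-of-outlier : ∀ {M i₀ j₁ x} → IsClique (K G) M → i₀ ∈ₛ M → j₁ ∈ₛ M →
    x ∈ₛ C i₀ → ¬ x ∈ₛ C j₁ → ∃ λ v → ∀ {j} → j ∈ₛ M → v ∈ₛ C j
  common-vertex-of-outlier {M} {i₀} {j₁} {x} M-clique i₀∈M j₁∈M x∈C₀ x∉C₁ = v , v∈
    where
    ∉⇒≢ : ∀ {y i j} → y ∈ₛ C i → ¬ y ∈ₛ C j → i ≢ j
    ∉⇒≢ y∈Ci y∉Cj refl = y∉Cj y∈Ci
    meeting = E-K⁻ G (M-clique i₀∈M j₁∈M (∉⇒≢ x∈C₀ x∉C₁))
    v = proj₁ meeting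
    v∈C₀ = proj₁ (proj₂ meeting)
    v∈C₁ = proj₂ (proj₂ meeting)
    only-v : ∀ {y} → y ∈ₛ C i₀ → y ∈ₛ C j₁ → y ≡ v
    only-v = shared-vertex-unique (C-maximal i₀) (C-maximal j₁) v∈C₀ v∈C₁ (x , x∈C₀ , x∉C₁)
    v∈ : ∀ {j} → j ∈ₛ M → v ∈ₛ C j
    v∈ {j} j∈M = decidable-stable (T? _) λ v∉Cj →
      let meets : ∀ {i} → i ∈ₛ M → v ∈ₛ C i → Meet (C j) (C i)
          meets i∈M v∈Ci = E-K⁻ G (M-clique j∈M i∈M (∉⇒≢ v∈Ci v∉Cj ∘ sym))
      in ¬meets-both {D = C j₁} {X = C j} (C-maximal i₀) (C-clique j₁) v∈C₀ v∈C₁ only-v (C-clique j) v∉Cj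
                     (meets i₀∈M v∈C₀) (meets j₁∈M v∈C₁)

  common-vertex : ∀ {M} → IsMaximalClique (K G) M → ∃ λ v → ∀ {j} → j ∈ₛ M → v ∈ₛ C j
  common-vertex {M} M-maximal = decide (all? λ j → T? (lookup M j) →-dec T? (lookup (C j) x))
    where
    open IsMaximalClique M-maximal
    i₀ = proj₁ nonempty
    x  = proj₁ (IsMaximalClique.nonempty (C-maximal i₀))
    decide : Dec (∀ j → j ∈ₛ M → x ∈ₛ C j) → ∃ λ v → ∀ {j} → j ∈ₛ M → v ∈ₛ C j
    decide (yes x∈all) = x , x∈all _
    decide (no ¬x∈all) =
      let j₁ , j₁∈M , x∉C₁ = counterexample (λ _ → T? _) (λ _ → T? _) ¬x∈all
      in common-vertex-of-outlier {M} clique (proj₂ nonempty) j₁∈M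
           (proj₂ (IsMaximalClique.nonempty (C-maximal i₀))) x∉C₁

  cliquesAt-surjective : ∀ {M} → IsMaximalClique (K G) M → ∃ λ v → cliquesAt v ≡ M
  cliquesAt-surjective M-maximal =
    let v , v∈ = common-vertex M-maximal
    in v , sym (maximal⊆clique⇒≡ (K G) M-maximal (cliquesAt-clique v) (∈-cliquesAt⁺ ∘ v∈))

  K∘K≅ : K (K G) ≅ G
  K∘K≅ = K≅ (K G) G cliquesAt cliquesAt-maximal cliquesAt-surjective cliquesAt-injective meet⇒E E⇒meet

-- Star colourings

K1-Free⇒adjacent : ∀ {G : Graph} {k c u} (B : Fin k → V G) → K1-Free (suc k) G →
  Injective _≡_ _≡_ B → (∀ i → E G c (B i)) → (∀ i j → i ≢ j → ¬ E G (B i) (B j)) →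
  E G c u → (∀ i → B i ≢ u) → ∃ λ i → E G u (B i)
K1-Free⇒adjacent {G} {c = c} {u} B claw-free B-injective cB B-independent cu B≢u =
  decidable-stable (any? λ i → T? (adj G u (B i))) λ ¬adjacent →
    claw-free (c , u Vector.∷ B , centre-adjacent , (λ _ _ → ∷-injective id B≢u B-injective) , independent ¬adjacent)
  where
  centre-adjacent : ∀ i → E G c ((u Vector.∷ B) i)
  centre-adjacent zero    = cu
  centre-adjacent (suc i) = cB i
  independent : ¬ (∃ λ i → E G u (B i)) → ∀ i j → i ≢ j → ¬ E G ((u Vector.∷ B) i) ((u Vector.∷ B) j)
  independent ¬adjacent zero    zero    i≢j _ = i≢j refl
  independent ¬adjacent zero    (suc j) _   e = ¬adjacent (j , e)
  independent ¬adjacent (suc i) zero    _   e = ¬adjacent (i , E-sym G e)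
  independent ¬adjacent (suc i) (suc j) i≢j e = B-independent i j (i≢j ∘ cong suc) e

module StarColouring (G : Graph) {k} (col : V G → Fin k) (star : IsStarColouring G k col) where

  proper : ProperColouring G k col
  proper = proj₁ star

  Repeated : V G → V G → Set
  Repeated v u = ∃ λ x → E G v x × col x ≡ col u × x ≢ u

  Lone : V G → V G → Set
  Lone v u = ¬ Repeated v u

  repeated? : ∀ v u → Dec (Repeated v u)
  repeated? v u = any? λ x → T? (adj G v x) ×-dec col x ≟ᶠ col u ×-dec ¬? (x ≟ᶠ u)

  lone-unique : ∀ {v u x} → Lone v u → E G v x → col x ≡ col u → x ≡ u
  lone-unique lone vx same = decidable-stable (_ ≟ᶠ _) λ x≢u → lone (_ , vx , same , x≢u)

  lone≢repeated-colour : ∀ {v u y} → E G v y → Repeated v y → Lone v u → col u ≢ col y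
  lone≢repeated-colour vy repeated lone same = lone (subst (Repeated _) (lone-unique lone vy (sym same)) repeated)

  -- The edges vu, vx and uy lie in one component of the subgraph coloured col v and col u,
  -- and the centre of that star would have to be an end of all three.
  no-bicoloured-P₄ : ∀ {x v u y} → E G v x → E G v u → E G u y →
    col x ≡ col u → col y ≡ col v → x ≢ u → y ≢ v → ⊥
  no-bicoloured-P₄ {x} {v} {u} {y} vx vu uy x~u y~v x≢u y≢v
    with proj₂ star (col v) (col u) (proper v u vu) v (inj₁ refl)
  ... | z , _ , centre with centre v u v∙ u∙ vu | centre v x v∙ x∙ vx | centre u y u∙ y∙ uy
    where
    W = λ w → col w ≡ col v ⊎ col w ≡ col u
    v∙ : ReachIn G W v v
    v∙ = here (inj₁ refl)
    u∙ : ReachIn G W v u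
    u∙ = step (inj₁ refl) vu (here (inj₂ refl))
    x∙ : ReachIn G W v x
    x∙ = step (inj₁ refl) vx (here (inj₂ x~u))
    y∙ : ReachIn G W v y
    y∙ = step (inj₁ refl) vu (step (inj₂ refl) uy (here (inj₁ y~v)))
  ... | inj₁ refl | _         | inj₁ refl = E-irrefl G vu refl
  ... | inj₁ refl | _         | inj₂ refl = y≢v refl
  ... | inj₂ refl | inj₁ refl | _         = E-irrefl G vu refl
  ... | inj₂ refl | inj₂ refl | _         = x≢u refl

  repeated⇒lone : ∀ {v u} → E G v u → Repeated v u → Lone u v
  repeated⇒lone vu (x , vx , x~u , x≢u) (y , uy , y~v , y≢v) = no-bicoloured-P₄ vx vu uy x~u y~v x≢u y≢v

  rainbow-bound : ∀ {m v} (h : Fin m → V G) → (∀ i → E G v (h i)) → Injective _≡_ _≡_ (col ∘ h) → suc m ≤ k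
  rainbow-bound {v = v} h vh col∘h-injective =
    injective⇒≤ (∷-injective col (λ i → proper v (h i) (vh i) ∘ sym) col∘h-injective)

  record Family (v : V G) (m : ℕ) (P : V G → V G → Set) : Set where
    field
      member    : Fin m → V G
      injective : Injective _≡_ _≡_ member
      adjacent  : ∀ i → E G v (member i)
      property  : ∀ i → P v (member i)

  lone-rainbow : ∀ {v m} (F : Family v m Lone) → Injective _≡_ _≡_ (col ∘ Family.member F)
  lone-rainbow F {i} {j} same = injective (lone-unique (property j) (adjacent i) same)
    where open Family F

module RegularStarColouring (p : ℕ) (2≤p : 2 ≤ p) (G : Graph) (col : V G → Fin (p + 2))
  (star : IsStarColouring G (p + 2) col) (regular : Regular (2 * p) G) where

  open StarColouring G col star public

  loneᵇ repeatedᵇ : V G → V G → Bool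
  loneᵇ     v u = adj G v u ∧ not ⌊ repeated? v u ⌋
  repeatedᵇ v u = adj G v u ∧ ⌊ repeated? v u ⌋

  loneᵇ⁺ : ∀ {v u} → E G v u → Lone v u → T (loneᵇ v u)
  loneᵇ⁺ vu lone = Equivalence.from T-∧ (vu , ¬T⇒T-not (lone ∘ toWitness))

  loneᵇ⁻ : ∀ {v u} → T (loneᵇ v u) → E G v u × Lone v u
  loneᵇ⁻ {v} {u} h = let vu , ¬repeated = Equivalence.to (T-∧ {adj G v u}) h in vu , T-not⇒¬T ¬repeated ∘ fromWitness

  repeatedᵇ⁻ : ∀ {v u} → T (repeatedᵇ v u) → E G v u × Repeated v u
  repeatedᵇ⁻ {v} {u} h = let vu , repeated = Equivalence.to (T-∧ {adj G v u}) h in vu , toWitness repeated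

  #lone #repeated : V G → ℕ
  #lone     v = count (loneᵇ v)
  #repeated v = count (repeatedᵇ v)

  degree-split : ∀ v → 2 * p ≡ #repeated v + #lone v
  degree-split v = begin
    2 * p                  ≡⟨ regular v ⟨
    degree G v             ≡⟨ length-filterᵇ-tabulate (adj G v) id ⟩
    count (adj G v)        ≡⟨ count-split (adj G v) (λ u → ⌊ repeated? v u ⌋) ⟩
    #repeated v + #lone v  ∎
    where open ≡-Reasoning

  lone-family : ∀ {v m} → m ≤ #lone v → Family v m Lone
  lone-family {v} m≤ = let g , g-injective , g-lone = choose (loneᵇ v) m≤ in record
    { member = g ; injective = g-injective
    ; adjacent = proj₁ ∘ loneᵇ⁻ ∘ g-lone ; property = proj₂ ∘ loneᵇ⁻ ∘ g-lone }

  repeated-family : ∀ {v m} → m ≤ #repeated v → Family v m Repeated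
  repeated-family {v} m≤ = let g , g-injective , g-repeated = choose (repeatedᵇ v) m≤ in record
    { member = g ; injective = g-injective
    ; adjacent = proj₁ ∘ repeatedᵇ⁻ ∘ g-repeated ; property = proj₂ ∘ repeatedᵇ⁻ ∘ g-repeated }

  no-large-rainbow : ∀ {v} (h : Fin (2 + p) → V G) → (∀ i → E G v (h i)) → ¬ Injective _≡_ _≡_ (col ∘ h)
  no-large-rainbow h vh injective = 1+n≰n (≤-trans (rainbow-bound h vh injective) (≤-reflexive (+-comm p 2)))

  2+p≤2*p : 2 + p ≤ 2 * p
  2+p≤2*p = ≤-trans (+-monoˡ-≤ p 2≤p) (≤-reflexive (cong (p +_) (sym (+-identityʳ p))))

  3≤degree : ∀ v → 3 ≤ degree G v
  3≤degree v = subst (3 ≤_) (sym (regular v)) (≤-trans (+-monoʳ-≤ 2 (≤-trans (s≤s z≤n) 2≤p)) 2+p≤2*p)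

  -- p + 1 lone neighbours and one further neighbour of v, with v itself, need p + 3 colours.
  #lone≤p : ∀ v → #lone v ≤ p
  #lone≤p v = ≮⇒≥ λ p<#lone → case 1 ≤? #repeated v of λ where
    (yes 1≤#repeated) →
      let F = lone-family p<#lone
          open Family F
          open Family (repeated-family 1≤#repeated) renaming (member to y; adjacent to vy; property to y-repeated)
      in no-large-rainbow (y 0F Vector.∷ member) (λ { zero → vy 0F ; (suc i) → adjacent i })
           (∷-injective col (λ i → lone≢repeated-colour (vy 0F) (y-repeated 0F) (property i)) (lone-rainbow F))
    (no  #repeated≱1) →
      let #repeated≡0 = n≤0⇒n≡0 (≤-pred (≰⇒> #repeated≱1))
          2+p≤#lone = subst (2 + p ≤_) (trans (degree-split v) (cong (_+ #lone v) #repeated≡0)) 2+p≤2*p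
          F = lone-family 2+p≤#lone
      in no-large-rainbow (Family.member F) (Family.adjacent F) (lone-rainbow F)

  edge-has-lone-end : ∀ v u → ind (adj G v u) ≤ ind (loneᵇ v u) + ind (loneᵇ u v)
  edge-has-lone-end v u = ind-≤-+ λ vu → case repeated? v u of λ where
    (yes repeated) → inj₂ (loneᵇ⁺ (E-sym G vu) (repeated⇒lone vu repeated))
    (no  lone)     → inj₁ (loneᵇ⁺ vu lone)

  private
    n = size G

    ∑∑adj : ∑[ v < n ] ∑[ u < n ] ind (adj G v u) ≡ ∑[ v < n ] p + ∑[ v < n ] p
    ∑∑adj = begin
      ∑[ v < n ] ∑[ u < n ] ind (adj G v u)  ≡⟨ sum-cong-≗ row ⟩
      ∑[ v < n ] (p + p)                     ≡⟨ ∑-distrib-+ {n} (λ _ → p) (λ _ → p) ⟩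
      ∑[ v < n ] p + ∑[ v < n ] p            ∎
      where
      open ≡-Reasoning
      row : ∀ v → ∑[ u < n ] ind (adj G v u) ≡ p + p
      row v = trans (sym (length-filterᵇ-tabulate (adj G v) id)) (trans (regular v) (cong (p +_) (+-identityʳ p)))

    ∑#lone≤∑p : ∑[ v < n ] #lone v ≤ ∑[ v < n ] p
    ∑#lone≤∑p = ∑-mono-≤ #lone≤p

    double-count : ∑[ v < n ] p + ∑[ v < n ] p ≤ ∑[ v < n ] #lone v + ∑[ v < n ] #lone v
    double-count = begin
      ∑[ v < n ] p + ∑[ v < n ] p                                ≡⟨ ∑∑adj ⟨
      ∑[ v < n ] ∑[ u < n ] ind (adj G v u)                       ≤⟨ ∑-mono-≤ (λ v → ∑-mono-≤ (edge-has-lone-end v)) ⟩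
      ∑[ v < n ] ∑[ u < n ] (ind (loneᵇ v u) + ind (loneᵇ u v))  ≡⟨ ∑∑-symmetrise (λ v u → ind (loneᵇ v u)) ⟩
      ∑[ v < n ] #lone v + ∑[ v < n ] #lone v                     ∎
      where open ≤-Reasoning

  #lone≡p : ∀ v → #lone v ≡ p
  #lone≡p = ∑-mono-≤-tight #lone≤p (m+m≤n+n⇒m≤n double-count)

  edge-lone-once : ∀ v u → ind (adj G v u) ≡ ind (loneᵇ v u) + ind (loneᵇ u v)
  edge-lone-once = ∑∑-mono-≤-tight edge-has-lone-end (begin
    ∑[ v < n ] ∑[ u < n ] (ind (loneᵇ v u) + ind (loneᵇ u v))  ≡⟨ ∑∑-symmetrise (λ v u → ind (loneᵇ v u)) ⟩
    ∑[ v < n ] #lone v + ∑[ v < n ] #lone v                     ≤⟨ +-mono-≤ ∑#lone≤∑p ∑#lone≤∑p ⟩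
    ∑[ v < n ] p + ∑[ v < n ] p                                ≡⟨ ∑∑adj ⟨
    ∑[ v < n ] ∑[ u < n ] ind (adj G v u)                       ∎)
    where open ≤-Reasoning

  lone⇒repeated : ∀ {v u} → E G v u → Lone v u → Repeated u v
  lone⇒repeated {v} {u} vu lone = decidable-stable (repeated? u v) λ lone′ →
    case begin
      1                                  ≡⟨ T⇒ind≡1 vu ⟨
      ind (adj G v u)                    ≡⟨ edge-lone-once v u ⟩
      ind (loneᵇ v u) + ind (loneᵇ u v)  ≡⟨ cong₂ _+_ (T⇒ind≡1 (loneᵇ⁺ vu lone)) (T⇒ind≡1 (loneᵇ⁺ (E-sym G vu) lone′)) ⟩
      2                                  ∎
    of λ ()
    where open ≡-Reasoning

  #repeated≡p : ∀ v → #repeated v ≡ p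
  #repeated≡p v = +-cancelʳ-≡ p (#repeated v) p (begin
    #repeated v + p        ≡⟨ cong (#repeated v +_) (#lone≡p v) ⟨
    #repeated v + #lone v  ≡⟨ degree-split v ⟨
    2 * p                  ≡⟨ cong (p +_) (+-identityʳ p) ⟩
    p + p                  ∎)
    where open ≡-Reasoning

  private
    some-repeated : ∀ v → Family v 1 Repeated
    some-repeated v = repeated-family (≤-trans (≤-trans (s≤s z≤n) 2≤p) (≤-reflexive (sym (#repeated≡p v))))

  β : V G → Fin (p + 2)
  β v = col (Family.member (some-repeated v) 0F)

  -- Otherwise x, the neighbour defining β v, the p lone neighbours and v need p + 3 colours.
  repeated-colour : ∀ {v x} → E G v x → Repeated v x → col x ≡ β v
  repeated-colour {v} {x} vx x-repeated = decidable-stable (col x ≟ᶠ β v) λ x≁y →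
    no-large-rainbow (x Vector.∷ y 0F Vector.∷ member) neighbours
      (∷-injective col (λ { zero → x≁y ∘ sym ; (suc i) → lone≢repeated-colour vx x-repeated (property i) })
        (∷-injective col (λ i → lone≢repeated-colour (vy 0F) (y-repeated 0F) (property i)) (lone-rainbow F)))
    where
    F = lone-family (≤-reflexive (sym (#lone≡p v)))
    open Family F
    open Family (some-repeated v) renaming (member to y; adjacent to vy; property to y-repeated)
    neighbours : ∀ i → E G v ((x Vector.∷ y 0F Vector.∷ member) i)
    neighbours zero          = vx
    neighbours (suc zero)    = vy 0F
    neighbours (suc (suc i)) = adjacent i

  ¬β⇒lone : ∀ {v x} → E G v x → col x ≢ β v → Lone v x
  ¬β⇒lone vx x≁β = x≁β ∘ repeated-colour vx

  β⇒repeated : ∀ {v x} → col x ≡ β v → Repeated v x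
  β⇒repeated {v} {x} x~β = decidable-stable (repeated? v x) λ lone →
    lone≢repeated-colour (Family.adjacent (some-repeated v) 0F) (Family.property (some-repeated v) 0F) lone x~β

  β-edge : ∀ {v u} → E G v u → col u ≡ β v ⊎ col v ≡ β u
  β-edge {v} {u} vu with repeated? v u
  ... | yes repeated = inj₁ (repeated-colour vu repeated)
  ... | no  lone     = inj₂ (repeated-colour (E-sym G vu) (lone⇒repeated vu lone))

  β-edge-exclusive : ∀ {v u} → E G v u → col u ≡ β v → col v ≢ β u
  β-edge-exclusive vu u~βv v~βu = repeated⇒lone vu (β⇒repeated u~βv) (β⇒repeated v~βu)

module ClawFreeRegularStarColouring (p : ℕ) (2≤p : 2 ≤ p) (G : Graph) (col : V G → Fin (p + 2))
  (star : IsStarColouring G (p + 2) col) (regular : Regular (2 * p) G) (claw-free : K1-Free (suc p) G) where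

  open RegularStarColouring p 2≤p G col star regular public

  common-neighbour-unique : ∀ {v u y w} → E G v u → col v ≡ β u → E G v y → E G u y → col y ≡ β v →
    E G v w → E G u w → w ≡ y
  common-neighbour-unique {v} {u} {y} {w} vu v~βu vy uy y~βv vw uw = case col w ≟ᶠ β v of λ where
    (yes w~βv) → lone-unique (¬β⇒lone uy λ y~βu → proper v y vy (trans v~βu (sym y~βu))) uw (trans w~βv (sym y~βv))
    (no  w≁βv) → ⊥-elim (case β-edge vw , β-edge uw of λ where
      (inj₁ w~βv , _)         → w≁βv w~βv
      (inj₂ v~βw , inj₁ w~βu) → proper v w vw (trans v~βu (sym w~βu))
      (inj₂ v~βw , inj₂ u~βw) → proper v u vu (trans v~βw (sym u~βw)))

  unique-triangle : ∀ {v u} → E G v u → col v ≡ β u →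
    Σ (V G) λ w → (E G v w × E G u w) × (∀ w′ → E G v w′ → E G u w′ → w′ ≡ w)
  unique-triangle {v} {u} vu v~βu = y , (vy , uy) , λ w → common-neighbour-unique vu v~βu vy uy (colour-β i)
    where
    open Family (repeated-family {v} {p} (≤-reflexive (sym (#repeated≡p v))))
    colour-β : ∀ i → col (member i) ≡ β v
    colour-β i = repeated-colour (adjacent i) (property i)
    found : ∃ λ i → E G u (member i)
    found = K1-Free⇒adjacent {G} member claw-free injective adjacent
              (λ i j _ e → proper _ _ e (trans (colour-β i) (sym (colour-β j))))
              vu (λ i eq → β-edge-exclusive vu (subst (λ z → col z ≡ β v) eq (colour-β i)) v~βu)
    i = proj₁ found
    y = member i
    vy = adjacent i
    uy = proj₂ found

  locallyLinear : LocallyLinear G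
  locallyLinear u v uv with β-edge uv
  ... | inj₂ u~βv = unique-triangle uv u~βv
  ... | inj₁ v~βu =
    let w , (vw , uw) , unique = unique-triangle (E-sym G uv) v~βu
    in w , (uw , vw) , λ w′ uw′ vw′ → unique w′ vw′ uw′

theorem16 : (p : ℕ) → 2 ≤ p → (G : Graph) →
    Connected G → K1-Free (p + 1) G → Regular (2 * p) G →
    StarColourable (p + 2) G →
    LocallyLinear G × IsCliqueGraph G × (K (K G) ≅ G)
theorem16 p 2≤p G _ claw-free regular (col , star) = locallyLinear , (K G , K∘K≅) , K∘K≅
  where
  open ClawFreeRegularStarColouring p 2≤p G col star regular (subst (λ q → K1-Free q G) (+-comm p 1) claw-free)
  open LocallyLinearGraph G locallyLinear using (nonadjacent-neighbours)
  open CliqueGraphOfLocallyLinear G locallyLinear (nonadjacent-neighbours ∘ 3≤degree)
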